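{- Let $\mathbf{Q}$ be a non-flat QB-algebra (i.e. $1\neq 0$ in $\mathbf{Q}$). Then $x^{*}\neq x$ for every $x\in Q$.
   Context: A quasi-lattice is an algebra $\langle L;\vee,\wedge\rangle$ such that for all $x,y,z$: $\vee,\wedge$ are commutative and associative; $x\vee(x\wedge y)=x\vee x$ and $x\wedge(x\vee y)=x\wedge x$; $x\vee(y\vee y)=x\vee y$ and $x\wedge(y\wedge y)=x\wedge y$; $x\vee x=x\wedge x$; distributive if both distributive laws hold. A QB-algebra is an algebra $\langle Q;\vee,\wedge,{}^{*},0,1\rangle$ of type $\langle 2,2,1,0,0\rangle$ such that $\langle Q;\vee,\wedge\rangle$ is a distributive quasi-lattice and for all $x$: $x\vee 1=1$, $x\wedge 0=0$, $x\vee x^{*}=1$, $x\wedge x^{*}=0$, $(x\wedge x)^{*}=x^{*}\vee x^{*}$, $x^{**}=x$. A QB-algebra is flat if $1=0$. -}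

module Defs where

open import Level using (Level; suc)
open import Relation.Binary.PropositionalEquality using (_≡_)

record QBAlgebra (c : Level) : Set (suc c) where
  infixr 6 _∨_
  infixr 7 _∧_
  field
    Q    : Set c
    _∨_  : Q → Q → Q
    _∧_  : Q → Q → Q
    _*   : Q → Q
    𝟘    : Q
    𝟙    : Q
    ∨-comm  : ∀ x y → x ∨ y ≡ y ∨ x
    ∧-comm  : ∀ x y → x ∧ y ≡ y ∧ x
    ∨-assoc : ∀ x y z → (x ∨ y) ∨ z ≡ x ∨ (y ∨ z)
    ∧-assoc : ∀ x y z → (x ∧ y) ∧ z ≡ x ∧ (y ∧ z)
    ∨-absorb : ∀ x y → x ∨ (x ∧ y) ≡ x ∨ x
    ∧-absorb : ∀ x y → x ∧ (x ∨ y) ≡ x ∧ x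
    ∨-idem-r : ∀ x y → x ∨ (y ∨ y) ≡ x ∨ y
    ∧-idem-r : ∀ x y → x ∧ (y ∧ y) ≡ x ∧ y
    ∨x≡∧x   : ∀ x → x ∨ x ≡ x ∧ x
    ∧-distrib-∨ : ∀ x y z → x ∧ (y ∨ z) ≡ (x ∧ y) ∨ (x ∧ z)
    ∨-distrib-∧ : ∀ x y z → x ∨ (y ∧ z) ≡ (x ∨ y) ∧ (x ∨ z)
    ∨-one   : ∀ x → x ∨ 𝟙 ≡ 𝟙
    ∧-zero  : ∀ x → x ∧ 𝟘 ≡ 𝟘
    ∨-compl : ∀ x → x ∨ (x *) ≡ 𝟙
    ∧-compl : ∀ x → x ∧ (x *) ≡ 𝟘
    *-∧x    : ∀ x → (x ∧ x) * ≡ (x *) ∨ (x *)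
    *-invol : ∀ x → (x *) * ≡ x

Flat : ∀ {c} → QBAlgebra c → Set c
Flat A = QBAlgebra.𝟙 A ≡ QBAlgebra.𝟘 A

module Submission where

open import Defs
open import Level using (Level)
open import Relation.Nullary using (¬_)
open import Relation.Binary.PropositionalEquality using (_≡_; sym; subst; module ≡-Reasoning)

*-fixed⇒flat : ∀ {c} (A : QBAlgebra c) (x : QBAlgebra.Q A) →
  QBAlgebra._* A x ≡ x → Flat A
*-fixed⇒flat A x x*≡x = begin
  𝟙      ≡⟨ sym (subst (λ y → x ∨ y ≡ 𝟙) x*≡x (∨-compl x)) ⟩
  x ∨ x  ≡⟨ ∨x≡∧x x ⟩
  x ∧ x  ≡⟨ subst (λ y → x ∧ y ≡ 𝟘) x*≡x (∧-compl x) ⟩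
  𝟘      ∎
  where
  open QBAlgebra A
  open ≡-Reasoning

lemma3p6 : ∀ {c : Level} (A : QBAlgebra c) → ¬ Flat A →
    ∀ (x : QBAlgebra.Q A) → ¬ (QBAlgebra._* A x ≡ x)
lemma3p6 A nonFlat x x*≡x = nonFlat (*-fixed⇒flat A x x*≡x)
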